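{- For any graph $G$ of order $n$ with maximum degree $\Delta$, $\gamma^{NN}_{s}(G)\ge -n+2\left\lceil\frac{\Delta+1}{2}\right\rceil$. In particular, for a tree $T$ of order $n$ with maximum degree $\Delta$, equality $\gamma^{NN}_{s}(T)= -n+2\lceil\frac{\Delta+1}{2}\rceil$ holds if and only if $T\in\Theta$.
   Context: All graphs are finite and simple. For a vertex $v$, $N[v]=N(v)\cup\{v\}$; for $f:V(G)\to\mathbb{R}$ and $S\subseteq V(G)$, $f(S)=\sum_{v\in S}f(v)$. A nonnegative signed dominating function (NNSDF) of $G$ is a function $f:V(G)\to\{ -1,1\}$ with $f(N[v])\ge 0$ for every $v\in V(G)$; $\gamma^{NN}_s(G)$ is the minimum of $f(V(G))$ over all NNSDFs $f$ of $G$. $\Theta$ is the collection of all trees $T$ with maximum degree $\Delta=\Delta(T)$ obtained as follows: $T$ contains a vertex $u$ of degree $\Delta$ (so $T$ contains the star $K_{1,\Delta}$ on $N[u]$ with center $u$), every vertex of $V(T)\setminus N[u]$ is a leaf whose (unique) neighbor lies in a set $S\subseteq N(u)$ with $|S|=\lfloor\frac{\Delta}{2}\rfloor$, and $\deg(s)\le 3$ for all $s\in S$. -}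

module Defs where

open import Data.Nat using (ℕ; zero; suc; _≤_; ⌈_/2⌉; ⌊_/2⌋) renaming (_+_ to _+ℕ_)
open import Data.Integer using (ℤ; +_; -_; _+_; _*_; 1ℤ; -1ℤ; 0ℤ)
open import Data.Fin using (Fin; zero; suc)
open import Data.Fin.Subset using (Subset; _∈_; _∉_; ∣_∣)
open import Data.Bool using (Bool; true; false; if_then_else_; _∨_)
open import Data.List using (List; []; _∷_; length; last)
open import Data.List.Relation.Unary.Unique.Propositional using (Unique)
open import Data.Maybe using (just)
open import Data.Product using (Σ; ∃; ∃-syntax; _×_; _,_)
open import Data.Sum using (_⊎_)
open import Relation.Binary.PropositionalEquality using (_≡_; _≢_)
open import Relation.Nullary using (¬_)
open import Data.Fin using (_≟_)
open import Relation.Nullary.Decidable using (⌊_⌋)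

record Graph (n : ℕ) : Set where
  field
    adj   : Fin n → Fin n → Bool
    sym   : ∀ u v → adj u v ≡ adj v u
    irrefl : ∀ v → adj v v ≡ false
open Graph public

sumℕ : ∀ {n} → (Fin n → ℕ) → ℕ
sumℕ {zero}  f = 0
sumℕ {suc n} f = f zero +ℕ sumℕ (λ i → f (suc i))

sumℤ : ∀ {n} → (Fin n → ℤ) → ℤ
sumℤ {zero}  f = 0ℤ
sumℤ {suc n} f = f zero + sumℤ (λ i → f (suc i))

Adj : ∀ {n} → Graph n → Fin n → Fin n → Set
Adj G u v = adj G u v ≡ true

deg : ∀ {n} → Graph n → Fin n → ℕ
deg G v = sumℕ (λ w → if adj G v w then 1 else 0)

-- Δ is the maximum degree of G (requires a vertex, hence n ≥ 1).
IsMaxDegree : ∀ {n} → Graph n → ℕ → Set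
IsMaxDegree G Δ = (∃[ v ] deg G v ≡ Δ) × (∀ v → deg G v ≤ Δ)

inN[_] : ∀ {n} → Graph n → Fin n → Fin n → Bool
inN[ G ] v w = ⌊ v ≟ w ⌋ ∨ adj G v w

fN : ∀ {n} → Graph n → (Fin n → ℤ) → Fin n → ℤ
fN G f v = sumℤ (λ w → if inN[ G ] v w then f w else 0ℤ)

weight : ∀ {n} → (Fin n → ℤ) → ℤ
weight f = sumℤ f

IsNNSDF : ∀ {n} → Graph n → (Fin n → ℤ) → Set
IsNNSDF G f = (∀ v → f v ≡ 1ℤ ⊎ f v ≡ -1ℤ) × (∀ v → 0ℤ Data.Integer.≤ fN G f v)

IsGammaNN : ∀ {n} → Graph n → ℤ → Set
IsGammaNN G k =
  (∃[ f ] (IsNNSDF G f × weight f ≡ k)) × (∀ f → IsNNSDF G f → k Data.Integer.≤ weight f)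

Chain : ∀ {n} → Graph n → List (Fin n) → Set
Chain G []            = Data.Unit.⊤ where import Data.Unit
Chain G (x ∷ [])      = Data.Unit.⊤ where import Data.Unit
Chain G (x ∷ y ∷ xs)  = Adj G x y × Chain G (y ∷ xs)

Connected : ∀ {n} → Graph n → Set
Connected {n} G = ∀ u v → ∃[ ys ] (Chain G (u ∷ ys) × last (u ∷ ys) ≡ just v)

IsCycle : ∀ {n} → Graph n → List (Fin n) → Set
IsCycle G [] = Data.Empty.⊥ where import Data.Empty
IsCycle {n} G (v ∷ vs) = 3 ≤ length (v ∷ vs) × Unique (v ∷ vs) × Chain G (v ∷ vs)
                     × Σ (Fin n) (λ x → last (v ∷ vs) ≡ just x × Adj G x v)

Acyclic : ∀ {n} → Graph n → Set
Acyclic G = ∀ c → ¬ IsCycle G c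

IsTree : ∀ {n} → Graph n → Set
IsTree G = Connected G × Acyclic G

InΘ : ∀ {n} → Graph n → ℕ → Set
InΘ {n} T Δ = ∃[ u ] (deg T u ≡ Δ × Σ (Subset n) λ S →
    (∀ s → s ∈ S → Adj T u s)
  × ∣ S ∣ ≡ ⌊ Δ /2⌋
  × (∀ v → v ≢ u → ¬ Adj T u v → deg T v ≡ 1 × (∀ w → Adj T v w → w ∈ S))
  × (∀ s → s ∈ S → deg T s ≤ 3))

bound : ℕ → ℕ → ℤ
bound n Δ = - (+ n) + (+ 2) * (+ ⌈ suc Δ /2⌉)

-- A ±1 function with P positive vertices among n has weight −n + 2P. At a vertex u of
-- maximum degree Δ the condition f(N[u]) ≥ 0 puts at least ⌈(Δ+1)/2⌉ positive vertices into
-- N[u], which gives the bound. If a tree attains it, every positive vertex lies in N[u].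
-- Since a tree has no triangles and no 4-cycles, a vertex outside N[u] then sees at most one
-- positive vertex, so it is a leaf hanging from a positive neighbour of u; and a positive
-- neighbour of u sees at most two, so it has degree at most 3. Thus the positive neighbours
-- of u form S. (If u itself is negative, all of N(u) is positive, which forces Δ ≤ 2 and
-- leaves no vertex outside N[u].) Conversely, on a tree of Θ the function that is positive
-- exactly on {u} ∪ S attains the bound.

module Submission where

open import Defs hiding (sym)
open import Data.Nat using (ℕ)
open import Data.Integer using (ℤ; _≤_)
open import Data.Product using (_×_)
open import Relation.Binary.PropositionalEquality using (_≡_)
open import Function.Bundles using (_⇔_)

open import Data.Bool using (Bool; true; false; not; _∧_; _∨_; if_then_else_)
open import Data.Bool.Properties using (∨-zeroʳ; ∧-comm)
open import Data.Empty using (⊥; ⊥-elim)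
open import Data.Fin using (Fin; zero; suc; _≟_)
open import Data.Fin.Properties using (0≢1+n)
open import Data.Fin.Subset using (Subset; _∈_; ∣_∣; inside; outside) renaming (⊥ to ∅)
open import Data.Fin.Subset.Properties using (∉⊥; ∣⊥∣≡0)
open import Data.Integer as ℤ using (+_; -_; _+_; _*_; _-_; 1ℤ; -1ℤ; 0ℤ; +≤+)
import Data.Integer.Properties as ℤ
open import Algebra.Properties.AbelianGroup ℤ.+-0-abelianGroup
  using () renaming (∙-cancelˡ to +-cancelˡ)
open import Data.Integer.Tactic.RingSolver using (solve-∀)
open import Data.List using ([]; _∷_)
open import Data.List.Relation.Unary.All using ([]; _∷_)
open import Data.List.Relation.Unary.AllPairs using ([]; _∷_)
open import Data.Nat as ℕ using (zero; suc; z≤n; s≤s; s≤s⁻¹; ⌈_/2⌉; ⌊_/2⌋)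
import Data.Nat.Properties as ℕ
import Data.Fin.Properties as Fin
open import Data.Product using (Σ-syntax; _,_; proj₁; proj₂)
open import Data.Sum using (_⊎_; inj₁; inj₂)
open import Data.Unit using (tt)
open import Data.Vec using ([]; _∷_; tabulate; lookup; here; there)
open import Data.Vec.Properties using ([]=⇒lookup; lookup⇒[]=; lookup∘tabulate)
open import Function using (_∘_; mk⇔)
open import Relation.Binary.PropositionalEquality
  using (refl; sym; trans; cong; cong₂; subst; _≢_; module ≡-Reasoning)
open import Relation.Nullary using (¬_; yes; no)
open import Relation.Nullary.Decidable using (⌊_⌋)

private
  variable
    n : ℕ

true≢false : true ≢ false
true≢false ()

∧≡true⁻ : ∀ {a b} → a ∧ b ≡ true → a ≡ true × b ≡ true
∧≡true⁻ {true} b≡true = refl , b≡true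

not≡true⁻ : ∀ {a} → not a ≡ true → a ≡ false
not≡true⁻ {false} _ = refl

∨≡true⁻ : ∀ {a b} → a ∨ b ≡ true → a ≡ true ⊎ b ≡ true
∨≡true⁻ {true}  _       = inj₁ refl
∨≡true⁻ {false} b≡true  = inj₂ b≡true

∨≡trueʳ : ∀ a {b} → b ≡ true → a ∨ b ≡ true
∨≡trueʳ a b≡true = trans (cong (a ∨_) b≡true) (∨-zeroʳ a)

≟-refl : (i : Fin n) → ⌊ i ≟ i ⌋ ≡ true
≟-refl i with i ≟ i
... | yes _  = refl
... | no i≢i = ⊥-elim (i≢i refl)

≟-sound : (i j : Fin n) → ⌊ i ≟ j ⌋ ≡ true → i ≡ j
≟-sound i j _ with i ≟ j
≟-sound i j _  | yes i≡j = i≡j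
≟-sound i j () | no _

count : (Fin n → Bool) → ℕ
count g = sumℕ (λ i → if g i then 1 else 0)

count-cong : ∀ {g h : Fin n → Bool} → (∀ i → g i ≡ h i) → count g ≡ count h
count-cong {zero}  g≗h = refl
count-cong {suc n} {g} {h} g≗h rewrite g≗h zero =
  cong ((if h zero then 1 else 0) ℕ.+_) (count-cong (g≗h ∘ suc))

count-mono : ∀ {g h : Fin n → Bool} → (∀ i → g i ≡ true → h i ≡ true) → count g ℕ.≤ count h
count-mono {zero}  g⊆h = z≤n
count-mono {suc n} {g} {h} g⊆h with g zero in g0 | h zero in h0
... | true  | true  = s≤s (count-mono (g⊆h ∘ suc))
... | false | true  = ℕ.m≤n⇒m≤1+n (count-mono (g⊆h ∘ suc))
... | false | false = count-mono (g⊆h ∘ suc)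
... | true  | false = ⊥-elim (true≢false (trans (sym (g⊆h zero g0)) h0))

count-split : (g h : Fin n → Bool) →
              count g ≡ count (λ i → g i ∧ h i) ℕ.+ count (λ i → g i ∧ not (h i))
count-split {zero}  g h = refl
count-split {suc n} g h with g zero | h zero
... | true  | true  = cong suc (count-split (g ∘ suc) (h ∘ suc))
... | true  | false = trans (cong suc (count-split (g ∘ suc) (h ∘ suc))) (sym (ℕ.+-suc _ _))
... | false | _     = count-split (g ∘ suc) (h ∘ suc)

count-∨-disjoint : (g h : Fin n → Bool) → (∀ i → g i ≡ true → ¬ h i ≡ true) →
                   count (λ i → g i ∨ h i) ≡ count g ℕ.+ count h
count-∨-disjoint {zero}  g h disjoint = refl
count-∨-disjoint {suc n} g h disjoint with g zero in g0 | h zero in h0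
... | true  | true  = ⊥-elim (disjoint zero g0 h0)
... | true  | false = cong suc (count-∨-disjoint (g ∘ suc) (h ∘ suc) (disjoint ∘ suc))
... | false | true  = trans (cong suc (count-∨-disjoint (g ∘ suc) (h ∘ suc) (disjoint ∘ suc)))
                           (sym (ℕ.+-suc _ _))
... | false | false = count-∨-disjoint (g ∘ suc) (h ∘ suc) (disjoint ∘ suc)

count-complement : (g : Fin n → Bool) → count g ℕ.+ count (not ∘ g) ≡ n
count-complement {n} g = trans (sym (count-split (λ _ → true) g)) (count-true n)
  where
  count-true : ∀ n → count {n} (λ _ → true) ≡ n
  count-true zero    = refl
  count-true (suc n) = cong suc (count-true n)

count≥1 : ∀ (g : Fin n → Bool) i → g i ≡ true → 1 ℕ.≤ count g
count≥1 g zero    gi rewrite gi = s≤s z≤n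
count≥1 g (suc i) gi = ℕ.≤-trans (count≥1 (g ∘ suc) i gi) (ℕ.m≤n+m _ _)

count-witness : (g : Fin n → Bool) → 1 ℕ.≤ count g → Σ[ i ∈ Fin n ] g i ≡ true
count-witness {suc n} g 1≤count with g zero in g0
... | true  = zero , g0
... | false with count-witness (g ∘ suc) 1≤count
... | i , gi = suc i , gi

count-∧≡count⇒⊆ : ∀ (g h : Fin n → Bool) → count (λ i → g i ∧ h i) ≡ count g →
                   ∀ i → g i ≡ true → h i ≡ true
count-∧≡count⇒⊆ g h full i gi with h i in hi
... | true  = refl
... | false = ⊥-elim (ℕ.<⇒≱ (count≥1 outside-h i (cong₂ _∧_ gi (cong not hi)))
                            (ℕ.≤-reflexive outside-h≡0))
  where
  open ≡-Reasoning
  outside-h : Fin _ → Bool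
  outside-h i = g i ∧ not (h i)
  outside-h≡0 : count outside-h ≡ 0
  outside-h≡0 = ℕ.+-cancelˡ-≡ (count g) _ 0 (begin
    count g ℕ.+ count outside-h                         ≡⟨ cong (ℕ._+ count outside-h) full ⟨
    count (λ i → g i ∧ h i) ℕ.+ count outside-h         ≡⟨ count-split g h ⟨
    count g                                             ≡⟨ ℕ.+-identityʳ (count g) ⟨
    count g ℕ.+ 0                                       ∎)

count-none : (g : Fin n → Bool) → (∀ i → ¬ g i ≡ true) → count g ≡ 0
count-none {zero}  g none = refl
count-none {suc n} g none with g zero in g0
... | true  = ⊥-elim (none zero g0)
... | false = count-none (g ∘ suc) (none ∘ suc)

count≤1 : (g : Fin n → Bool) → (∀ i j → g i ≡ true → g j ≡ true → i ≡ j) → count g ℕ.≤ 1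
count≤1 {zero}  g unique = z≤n
count≤1 {suc n} g unique with g zero in g0
... | true  = s≤s (ℕ.≤-reflexive (count-none (g ∘ suc) λ i gi → 0≢1+n (unique zero (suc i) g0 gi)))
... | false = count≤1 (g ∘ suc) λ i j gi gj → Fin.suc-injective (unique (suc i) (suc j) gi gj)

count-singleton : (i : Fin n) → count (λ j → ⌊ i ≟ j ⌋) ≡ 1
count-singleton i = ℕ.≤-antisym
  (count≤1 _ λ j k i≡j i≡k → trans (sym (≟-sound i j i≡j)) (≟-sound i k i≡k))
  (count≥1 _ i (≟-refl i))

count≥2 : ∀ (g : Fin n → Bool) i j → g i ≡ true → g j ≡ true → i ≢ j → 2 ℕ.≤ count g
count≥2 g i j gi gj i≢j = subst (2 ℕ.≤_) (sym (count-split g (λ k → ⌊ i ≟ k ⌋)))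
  (ℕ.+-mono-≤ (count≥1 (λ k → g k ∧ ⌊ i ≟ k ⌋) i (cong₂ _∧_ gi (≟-refl i)))
              (count≥1 (λ k → g k ∧ not ⌊ i ≟ k ⌋) j (cong₂ _∧_ gj (cong not i≟j≡false))))
  where
  i≟j≡false : ⌊ i ≟ j ⌋ ≡ false
  i≟j≡false with i ≟ j
  ... | yes i≡j = ⊥-elim (i≢j i≡j)
  ... | no _    = refl

count≤2 : ∀ (g : Fin n → Bool) i j → (∀ k → g k ≡ true → k ≡ i ⊎ k ≡ j) → count g ℕ.≤ 2
count≤2 g i j ⊆ij = subst (ℕ._≤ 2) (sym (count-split g (λ k → ⌊ i ≟ k ⌋)))
  (ℕ.+-mono-≤ {x = _} {y = 1} {u = _} {v = 1}
    (count≤1 _ λ k l k≡i l≡i → trans (sym (≟-sound i k (proj₂ (∧≡true⁻ k≡i))))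
                                      (≟-sound i l (proj₂ (∧≡true⁻ l≡i))))
    (count≤1 _ λ k l k≡j l≡j → trans (≡j k k≡j) (sym (≡j l l≡j))))
  where
  ≡j : ∀ k → (g k ∧ not ⌊ i ≟ k ⌋) ≡ true → k ≡ j
  ≡j k gk∧k≢i with i ≟ k | ∧≡true⁻ {g k} gk∧k≢i
  ... | yes _  | _ , ()
  ... | no i≢k | gk , _ with ⊆ij k gk
  ...   | inj₁ k≡i = ⊥-elim (i≢k (sym k≡i))
  ...   | inj₂ k≡j = k≡j

count-choose : ∀ (g : Fin n → Bool) {k} → k ℕ.≤ count g →
               Σ[ S ∈ Subset n ] (∀ i → i ∈ S → g i ≡ true) × ∣ S ∣ ≡ k
count-choose {n} g {zero} _ = ∅ , (λ _ i∈∅ → ⊥-elim (∉⊥ i∈∅)) , ∣⊥∣≡0 n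
count-choose {suc n} g {suc k} k<count with g zero in g0
... | true with count-choose (g ∘ suc) (s≤s⁻¹ k<count)
...   | S , S⊆g , ∣S∣≡k = inside ∷ S , ⊆g , cong suc ∣S∣≡k
  where
  ⊆g : ∀ i → i ∈ inside ∷ S → g i ≡ true
  ⊆g zero    here        = g0
  ⊆g (suc i) (there i∈S) = S⊆g i i∈S
count-choose {suc n} g {suc k} k<count | false with count-choose (g ∘ suc) k<count
...   | S , S⊆g , ∣S∣≡k = outside ∷ S , ⊆g , ∣S∣≡k
  where
  ⊆g : ∀ i → i ∈ outside ∷ S → g i ≡ true
  ⊆g (suc i) (there i∈S) = S⊆g i i∈S

∣S∣≡count∘lookup : (S : Subset n) → ∣ S ∣ ≡ count (lookup S)
∣S∣≡count∘lookup []            = refl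
∣S∣≡count∘lookup (inside ∷ S)  = cong suc (∣S∣≡count∘lookup S)
∣S∣≡count∘lookup (outside ∷ S) = ∣S∣≡count∘lookup S

∣tabulate∣ : (g : Fin n → Bool) → ∣ tabulate g ∣ ≡ count g
∣tabulate∣ g = trans (∣S∣≡count∘lookup (tabulate g)) (count-cong (lookup∘tabulate g))

∈tabulate⁻ : ∀ (g : Fin n → Bool) {i} → i ∈ tabulate g → g i ≡ true
∈tabulate⁻ g {i} i∈ = trans (sym (lookup∘tabulate g i)) ([]=⇒lookup i∈)

∈tabulate⁺ : ∀ (g : Fin n → Bool) {i} → g i ≡ true → i ∈ tabulate g
∈tabulate⁺ g {i} gi = lookup⇒[]= i (tabulate g) (trans (lookup∘tabulate g i) gi)

⌈n+n/2⌉≡n : ∀ n → ⌈ n ℕ.+ n /2⌉ ≡ n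
⌈n+n/2⌉≡n zero    = refl
⌈n+n/2⌉≡n (suc n) rewrite ℕ.+-suc n n = cong suc (⌈n+n/2⌉≡n n)

⌈/2⌉≤larger : ∀ {a b m} → a ℕ.+ b ≡ m → b ℕ.≤ a → ⌈ m /2⌉ ℕ.≤ a
⌈/2⌉≤larger {a} refl b≤a =
  ℕ.≤-trans (ℕ.⌈n/2⌉-mono (ℕ.+-monoʳ-≤ a b≤a)) (ℕ.≤-reflexive (⌈n+n/2⌉≡n a))

smaller≤larger : ∀ {a b m} → a ℕ.+ b ≡ m → ⌈ m /2⌉ ℕ.≤ a → b ℕ.≤ a
smaller≤larger {a} {b} {m} a+b≡m ⌈m/2⌉≤a =
  ℕ.≤-trans b≤⌊m/2⌋ (ℕ.≤-trans (ℕ.⌊n/2⌋≤⌈n/2⌉ m) ⌈m/2⌉≤a)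
  where
  b≤⌊m/2⌋ : b ℕ.≤ ⌊ m /2⌋
  b≤⌊m/2⌋ = ℕ.+-cancelʳ-≤ a b ⌊ m /2⌋ (begin
    b ℕ.+ a               ≡⟨ ℕ.+-comm b a ⟩
    a ℕ.+ b               ≡⟨ a+b≡m ⟩
    m                     ≡⟨ ℕ.⌊n/2⌋+⌈n/2⌉≡n m ⟨
    ⌊ m /2⌋ ℕ.+ ⌈ m /2⌉   ≤⟨ ℕ.+-monoʳ-≤ ⌊ m /2⌋ ⌈m/2⌉≤a ⟩
    ⌊ m /2⌋ ℕ.+ a         ∎)
    where open ℕ.≤-Reasoning

n≤⌈1+n/2⌉⇒n≤2 : ∀ {n} → n ℕ.≤ ⌈ suc n /2⌉ → n ℕ.≤ 2
n≤⌈1+n/2⌉⇒n≤2 {0}                 _ = z≤n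
n≤⌈1+n/2⌉⇒n≤2 {1}                 _ = s≤s z≤n
n≤⌈1+n/2⌉⇒n≤2 {2}                 _ = s≤s (s≤s z≤n)
n≤⌈1+n/2⌉⇒n≤2 {suc (suc (suc k))} (s≤s (s≤s 1+k≤⌊1+k/2⌋)) =
  ⊥-elim (ℕ.<⇒≱ (ℕ.⌊n/2⌋<n k) 1+k≤⌊1+k/2⌋)

signWeight : ℕ → ℕ → ℤ
signWeight n k = - (+ n) + (+ 2) * (+ k)

signWeight-mono : ∀ {k m} → k ℕ.≤ m → signWeight n k ≤ signWeight n m
signWeight-mono {n} k≤m = ℤ.+-monoʳ-≤ (- (+ n)) (ℤ.*-monoˡ-≤-nonNeg (+ 2) (+≤+ k≤m))

signWeight-injective : ∀ {k m} → signWeight n k ≡ signWeight n m → k ≡ m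
signWeight-injective {n} {k} {m} eq =
  ℤ.+-injective (ℤ.*-cancelˡ-≡ (+ 2) (+ k) (+ m) (+-cancelˡ (- (+ n)) _ _ eq))

difference≡signWeight : ∀ P Q → + P - + Q ≡ signWeight (P ℕ.+ Q) P
difference≡signWeight P Q =
  trans (ring (+ P) (+ Q)) (cong (λ m → - m + (+ 2) * (+ P)) (sym (ℤ.pos-+ P Q)))
  where
  ring : ∀ (a b : ℤ) → a - b ≡ - (a + b) + (+ 2) * a
  ring = solve-∀

module GraphProperties {n} (G : Graph n) where

  Adj-sym : ∀ {x y} → Adj G x y → Adj G y x
  Adj-sym {x} {y} xy = trans (Graph.sym G y x) xy

  Adj⇒≢ : ∀ {x y} → Adj G x y → x ≢ y
  Adj⇒≢ {x} xx refl with trans (sym (irrefl G x)) xx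
  ... | ()

  ∈N[]-self : ∀ v → inN[ G ] v v ≡ true
  ∈N[]-self v = cong (_∨ adj G v v) (≟-refl v)

  Adj⇒∈N[] : ∀ {v w} → Adj G v w → inN[ G ] v w ≡ true
  Adj⇒∈N[] {v} {w} vw = ∨≡trueʳ ⌊ v ≟ w ⌋ vw

  ∈N[]⁻ : ∀ {v w} → inN[ G ] v w ≡ true → v ≡ w ⊎ Adj G v w
  ∈N[]⁻ {v} {w} w∈N[v] with ∨≡true⁻ {⌊ v ≟ w ⌋} w∈N[v]
  ... | inj₁ v≟w = inj₁ (≟-sound v w v≟w)
  ... | inj₂ vw  = inj₂ vw

  count-N[] : ∀ v → count (inN[ G ] v) ≡ suc (deg G v)
  count-N[] v =
    trans (count-∨-disjoint (λ w → ⌊ v ≟ w ⌋) (adj G v) λ w v≟w vw → Adj⇒≢ vw (≟-sound v w v≟w))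
          (cong (ℕ._+ deg G v) (count-singleton v))

  module _ (acyclic : Acyclic G) where

    no-triangle : ∀ {u x y} → Adj G u x → Adj G u y → ¬ Adj G x y
    no-triangle ux uy xy = acyclic (_ ∷ _ ∷ _ ∷ [])
      ( s≤s (s≤s (s≤s z≤n))
      , ((Adj⇒≢ ux ∷ Adj⇒≢ uy ∷ []) ∷ (Adj⇒≢ xy ∷ []) ∷ [] ∷ [])
      , (ux , xy , tt)
      , (_ , refl , Adj-sym uy))

    common-neighbour-unique : ∀ {u v x y} → v ≢ u →
      Adj G u x → Adj G v x → Adj G u y → Adj G v y → x ≡ y
    common-neighbour-unique {u} {v} {x} {y} v≢u ux vx uy vy with x ≟ y
    ... | yes x≡y = x≡y
    ... | no  x≢y = ⊥-elim (acyclic (v ∷ x ∷ u ∷ y ∷ [])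
      ( s≤s (s≤s (s≤s z≤n))
      , ( (Adj⇒≢ vx ∷ v≢u ∷ Adj⇒≢ vy ∷ [])
        ∷ ((λ x≡u → Adj⇒≢ ux (sym x≡u)) ∷ x≢y ∷ [])
        ∷ (Adj⇒≢ uy ∷ [])
        ∷ [] ∷ [])
      , (vx , Adj-sym ux , uy , tt)
      , (y , refl , Adj-sym vy)))

-- Sign patterns

sign : Bool → ℤ
sign true  = 1ℤ
sign false = -1ℤ

posN negN : Graph n → (Fin n → Bool) → Fin n → ℕ
posN G p v = count (λ w → inN[ G ] v w ∧ p w)
negN G p v = count (λ w → inN[ G ] v w ∧ not (p w))

IsNNSDFSigns : Graph n → (Fin n → Bool) → Set
IsNNSDFSigns G p = ∀ v → negN G p v ℕ.≤ posN G p v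

module SignCounts {n} (G : Graph n) (p : Fin n → Bool) where
  open GraphProperties G

  posN+negN≡1+deg : ∀ v → posN G p v ℕ.+ negN G p v ≡ suc (deg G v)
  posN+negN≡1+deg v = trans (sym (count-split (inN[ G ] v) p)) (count-N[] v)

  posN≤count : ∀ v → posN G p v ℕ.≤ count p
  posN≤count v = count-mono {g = λ w → inN[ G ] v w ∧ p w} {h = p}
    λ w w∈N[v]∧pw → proj₂ (∧≡true⁻ w∈N[v]∧pw)

  ⌈1+deg/2⌉≤posN : IsNNSDFSigns G p → ∀ v → ⌈ suc (deg G v) /2⌉ ℕ.≤ posN G p v
  ⌈1+deg/2⌉≤posN nnsdf v = ⌈/2⌉≤larger (posN+negN≡1+deg v) (nnsdf v)

  posN-at-positive : ∀ {v} → p v ≡ true → posN G p v ≡ suc (count (λ w → adj G v w ∧ p w))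
  posN-at-positive {v} pv =
    trans (count-cong {g = λ w → inN[ G ] v w ∧ p w} split-off-v)
      (trans (count-∨-disjoint (λ w → ⌊ v ≟ w ⌋) (λ w → adj G v w ∧ p w)
                (λ w v≟w vw∧pw → Adj⇒≢ (proj₁ (∧≡true⁻ vw∧pw)) (≟-sound v w v≟w)))
             (cong (ℕ._+ count (λ w → adj G v w ∧ p w)) (count-singleton v)))
    where
    split-off-v : ∀ w → ((⌊ v ≟ w ⌋ ∨ adj G v w) ∧ p w) ≡ (⌊ v ≟ w ⌋ ∨ (adj G v w ∧ p w))
    split-off-v w with v ≟ w
    ... | yes refl = pv
    ... | no _     = refl

  negN≤posN-if-lone-negative : ∀ {v x} →
    (∀ w → (inN[ G ] v w ∧ not (p w)) ≡ true → w ≡ v) →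
    (inN[ G ] v x ∧ p x) ≡ true → negN G p v ℕ.≤ posN G p v
  negN≤posN-if-lone-negative {v} {x} lone x∈N[v]∧px = ℕ.≤-trans
    (count≤1 _ λ i j i∈ j∈ → trans (lone i i∈) (sym (lone j j∈)))
    (count≥1 _ x x∈N[v]∧px)

sum-of-signs : ∀ (f : Fin n → ℤ) (p b : Fin n → Bool) → (∀ w → f w ≡ sign (p w)) →
  sumℤ (λ w → if b w then f w else 0ℤ)
    ≡ + count (λ w → b w ∧ p w) - + count (λ w → b w ∧ not (p w))
sum-of-signs {zero}  f p b f≡sign = refl
sum-of-signs {suc n} f p b f≡sign
  rewrite f≡sign zero | sum-of-signs (f ∘ suc) (p ∘ suc) (b ∘ suc) (f≡sign ∘ suc)
  with b zero | p zero
... | true  | true  = sym (ℤ.+-assoc 1ℤ (+ P) (- (+ Q)))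
  where
  P = count (λ w → b (suc w) ∧ p (suc w))
  Q = count (λ w → b (suc w) ∧ not (p (suc w)))
... | true  | false = -1+[a-c]≡a-[1+c] (+ P) (+ Q)
  where
  P = count (λ w → b (suc w) ∧ p (suc w))
  Q = count (λ w → b (suc w) ∧ not (p (suc w)))
  -1+[a-c]≡a-[1+c] : ∀ (a c : ℤ) → -1ℤ + (a - c) ≡ a - (1ℤ + c)
  -1+[a-c]≡a-[1+c] = solve-∀
... | false | _     = ℤ.+-identityˡ _

module _ {n} (G : Graph n) {f : Fin n → ℤ} {p : Fin n → Bool}
         (f≡sign : ∀ w → f w ≡ sign (p w)) where

  fN≡posN-negN : ∀ v → fN G f v ≡ + posN G p v - + negN G p v
  fN≡posN-negN v = sum-of-signs f p (inN[ G ] v) f≡sign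

  weight≡signWeight : weight f ≡ signWeight n (count p)
  weight≡signWeight =
    trans (sum-of-signs f p (λ _ → true) f≡sign)
      (trans (difference≡signWeight (count p) _)
             (cong (λ m → signWeight m (count p)) (count-complement p)))

isPositive : ℤ → Bool
isPositive z = ⌊ z ℤ.≟ 1ℤ ⌋

±1≡sign∘isPositive : ∀ {z} → z ≡ 1ℤ ⊎ z ≡ -1ℤ → z ≡ sign (isPositive z)
±1≡sign∘isPositive (inj₁ refl) = refl
±1≡sign∘isPositive (inj₂ refl) = refl

IsNNSDF⇒signs : (G : Graph n) {f : Fin n → ℤ} → IsNNSDF G f →
  IsNNSDFSigns G (isPositive ∘ f) × weight f ≡ signWeight n (count (isPositive ∘ f))
IsNNSDF⇒signs G (±1 , nonneg) =
  (λ v → ℤ.drop‿+≤+ (ℤ.0≤i-j⇒j≤i (subst (0ℤ ≤_) (fN≡posN-negN G f≡sign v) (nonneg v)))) ,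
  weight≡signWeight G f≡sign
  where
  f≡sign = λ w → ±1≡sign∘isPositive (±1 w)

signs⇒IsNNSDF : (G : Graph n) {p : Fin n → Bool} → IsNNSDFSigns G p → IsNNSDF G (sign ∘ p)
signs⇒IsNNSDF G {p} nnsdf = ±1 , λ v →
  subst (0ℤ ≤_) (sym (fN≡posN-negN G (λ _ → refl) v)) (ℤ.i≤j⇒0≤j-i (+≤+ (nnsdf v)))
  where
  ±1 : ∀ w → sign (p w) ≡ 1ℤ ⊎ sign (p w) ≡ -1ℤ
  ±1 w with p w
  ... | true  = inj₁ refl
  ... | false = inj₂ refl

-- The lower bound

⌈1+deg/2⌉≤count : (G : Graph n) {p : Fin n → Bool} → IsNNSDFSigns G p →
                  ∀ v → ⌈ suc (deg G v) /2⌉ ℕ.≤ count p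
⌈1+deg/2⌉≤count G {p} nnsdf v = ℕ.≤-trans (⌈1+deg/2⌉≤posN nnsdf v) (posN≤count v)
  where open SignCounts G p

bound≤weight : (G : Graph n) (v : Fin n) {f : Fin n → ℤ} → IsNNSDF G f →
               bound n (deg G v) ≤ weight f
bound≤weight {n} G v nnsdf with IsNNSDF⇒signs G nnsdf
... | signs , weight≡ =
  subst (bound n (deg G v) ≤_) (sym weight≡) (signWeight-mono {n} (⌈1+deg/2⌉≤count G signs v))

-- Trees attaining the bound lie in Θ

module ExtremalSigns {n} (T : Graph n) (acyclic : Acyclic T)
                     {p : Fin n → Bool} (nnsdf : IsNNSDFSigns T p)
                     {u : Fin n} (extremal : count p ≡ ⌈ suc (deg T u) /2⌉) where
  open GraphProperties T
  open SignCounts T p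

  posN-centre≡count : posN T p u ≡ count p
  posN-centre≡count = ℕ.≤-antisym (posN≤count u)
    (subst (ℕ._≤ posN T p u) (sym extremal) (⌈1+deg/2⌉≤posN nnsdf u))

  positive⇒∈N[u] : ∀ {w} → p w ≡ true → inN[ T ] u w ≡ true
  positive⇒∈N[u] {w} = count-∧≡count⇒⊆ p (inN[ T ] u)
    (trans (count-cong (λ w → ∧-comm (p w) (inN[ T ] u w))) posN-centre≡count) w

  positive-near-centre : ∀ {s} x → Adj T u s → (inN[ T ] s x ∧ p x) ≡ true → x ≡ s ⊎ x ≡ u
  positive-near-centre {s} x us x∈N[s]∧px with ∧≡true⁻ {inN[ T ] s x} x∈N[s]∧px
  ... | x∈N[s] , px with ∈N[]⁻ {s} x∈N[s] | ∈N[]⁻ {u} (positive⇒∈N[u] px)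
  ...   | inj₁ s≡x | _        = inj₁ (sym s≡x)
  ...   | inj₂ _   | inj₁ u≡x = inj₂ (sym u≡x)
  ...   | inj₂ sx  | inj₂ ux  = ⊥-elim (no-triangle acyclic us ux sx)

  module _ {v} (v≢u : v ≢ u) (¬uv : ¬ Adj T u v) where

    outsider-negative : p v ≡ false
    outsider-negative with p v in pv
    ... | false = refl
    ... | true with ∈N[]⁻ {u} (positive⇒∈N[u] pv)
    ...   | inj₁ u≡v = ⊥-elim (v≢u (sym u≡v))
    ...   | inj₂ uv  = ⊥-elim (¬uv uv)

    outsider-is-leaf : deg T v ≡ 1 × (∀ w → Adj T v w → p w ≡ true × Adj T u w)
    outsider-is-leaf = deg≡1 , neighbour-positive-in-N[u]
      where
      positive-neighbour : ∀ {w} → (inN[ T ] v w ∧ p w) ≡ true → Adj T v w × Adj T u w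
      positive-neighbour {w} w∈N[v]∧pw with ∧≡true⁻ {inN[ T ] v w} w∈N[v]∧pw
      ... | w∈N[v] , pw with ∈N[]⁻ {v} w∈N[v] | ∈N[]⁻ {u} (positive⇒∈N[u] pw)
      ...   | inj₁ refl | _         = ⊥-elim (true≢false (trans (sym pw) outsider-negative))
      ...   | inj₂ vw   | inj₁ refl = ⊥-elim (¬uv (Adj-sym vw))
      ...   | inj₂ vw   | inj₂ uw   = vw , uw

      posN≤1 : posN T p v ℕ.≤ 1
      posN≤1 = count≤1 _ λ x y x∈ y∈ →
        common-neighbour-unique acyclic v≢u
          (proj₂ (positive-neighbour x∈)) (proj₁ (positive-neighbour x∈))
          (proj₂ (positive-neighbour y∈)) (proj₁ (positive-neighbour y∈))

      1≤negN : 1 ℕ.≤ negN T p v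
      1≤negN = count≥1 _ v (cong₂ _∧_ (∈N[]-self v) (cong not outsider-negative))

      deg≡1 : deg T v ≡ 1
      deg≡1 = ℕ.suc-injective (begin
        suc (deg T v)                   ≡⟨ posN+negN≡1+deg v ⟨
        posN T p v ℕ.+ negN T p v       ≡⟨ cong₂ ℕ._+_ posN≡1 negN≡1 ⟩
        2                               ∎)
        where
        open ≡-Reasoning
        posN≡1 = ℕ.≤-antisym posN≤1 (ℕ.≤-trans 1≤negN (nnsdf v))
        negN≡1 = ℕ.≤-antisym (ℕ.≤-trans (nnsdf v) posN≤1) 1≤negN

      neighbour-positive-in-N[u] : ∀ w → Adj T v w → p w ≡ true × Adj T u w
      neighbour-positive-in-N[u] w vw with p w in pw
      ... | true  = refl , proj₂ (positive-neighbour (cong₂ _∧_ (Adj⇒∈N[] vw) pw))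
      ... | false = ⊥-elim (ℕ.<⇒≱ (ℕ.≤-trans (s≤s (nnsdf v)) (s≤s posN≤1)) 2≤negN)
        where
        2≤negN : 2 ℕ.≤ negN T p v
        2≤negN = count≥2 _ v w (cong₂ _∧_ (∈N[]-self v) (cong not outsider-negative))
                               (cong₂ _∧_ (Adj⇒∈N[] vw) (cong not pw)) (Adj⇒≢ vw)

  centre-positive⇒InΘ : p u ≡ true → InΘ T (deg T u)
  centre-positive⇒InΘ pu = u , refl , S , S⊆N[u] , ∣S∣≡⌊deg/2⌋ , outsiders , S-deg≤3
    where
    inS : Fin n → Bool
    inS w = adj T u w ∧ p w

    S : Subset n
    S = tabulate inS

    S⊆N[u] : ∀ s → s ∈ S → Adj T u s
    S⊆N[u] s s∈S = proj₁ (∧≡true⁻ (∈tabulate⁻ inS s∈S))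

    ∣S∣≡⌊deg/2⌋ : ∣ S ∣ ≡ ⌊ deg T u /2⌋
    ∣S∣≡⌊deg/2⌋ = ℕ.suc-injective (begin
      suc ∣ S ∣                          ≡⟨ cong suc (∣tabulate∣ inS) ⟩
      suc (count inS)                    ≡⟨ posN-at-positive pu ⟨
      posN T p u                         ≡⟨ posN-centre≡count ⟩
      count p                            ≡⟨ extremal ⟩
      suc ⌊ deg T u /2⌋                  ∎)
      where open ≡-Reasoning

    outsiders : ∀ v → v ≢ u → ¬ Adj T u v → deg T v ≡ 1 × (∀ w → Adj T v w → w ∈ S)
    outsiders v v≢u ¬uv with outsider-is-leaf v≢u ¬uv
    ... | deg≡1 , neighbours = deg≡1 , λ w vw →
      ∈tabulate⁺ inS (cong₂ _∧_ (proj₂ (neighbours w vw)) (proj₁ (neighbours w vw)))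

    S-deg≤3 : ∀ s → s ∈ S → deg T s ℕ.≤ 3
    S-deg≤3 s s∈S = s≤s⁻¹ (subst (ℕ._≤ 4) (posN+negN≡1+deg s)
                      (ℕ.+-mono-≤ posN≤2 (ℕ.≤-trans (nnsdf s) posN≤2)))
      where
      posN≤2 : posN T p s ℕ.≤ 2
      posN≤2 = count≤2 _ s u λ x → positive-near-centre x (S⊆N[u] s s∈S)

  module _ (pu : p u ≡ false) where

    lone-positive : ∀ {s} x → Adj T u s → (inN[ T ] s x ∧ p x) ≡ true → x ≡ s
    lone-positive x us x∈N[s]∧px with positive-near-centre x us x∈N[s]∧px
    ... | inj₁ x≡s  = x≡s
    ... | inj₂ refl = ⊥-elim (true≢false (trans (sym (proj₂ (∧≡true⁻ x∈N[s]∧px))) pu))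

    neighbour-positive : ∀ {v} → Adj T u v → p v ≡ true
    neighbour-positive {v} uv with p v in pv
    ... | true  = refl
    ... | false with count-witness _ (ℕ.≤-trans
                       (count≥1 _ v (cong₂ _∧_ (∈N[]-self v) (cong not pv))) (nnsdf v))
    ...   | x , x∈N[v]∧px with lone-positive x uv x∈N[v]∧px
    ...     | refl = ⊥-elim (true≢false (trans (sym (proj₂ (∧≡true⁻ x∈N[v]∧px))) pv))

    deg≤2 : deg T u ℕ.≤ 2
    deg≤2 = n≤⌈1+n/2⌉⇒n≤2 (begin
      deg T u     ≤⟨ count-mono {g = adj T u} {h = λ w → inN[ T ] u w ∧ p w}
                       (λ w uw → cong₂ _∧_ (Adj⇒∈N[] uw) (neighbour-positive uw)) ⟩
      posN T p u  ≡⟨ trans posN-centre≡count extremal ⟩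
      ⌈ suc (deg T u) /2⌉ ∎)
      where open ℕ.≤-Reasoning

    no-outsider : ∀ {v} → v ≢ u → ¬ Adj T u v → ⊥
    no-outsider {v} v≢u ¬uv with outsider-is-leaf v≢u ¬uv
    ... | deg≡1 , neighbours with count-witness (adj T v) (ℕ.≤-reflexive (sym deg≡1))
    ...   | w , vw with neighbours w vw
    ...     | _ , uw = ℕ.<⇒≱ (ℕ.≤-trans (s≤s (nnsdf w)) (s≤s posN≤1)) 2≤negN
      where
      posN≤1 : posN T p w ℕ.≤ 1
      posN≤1 = count≤1 _ λ x y x∈ y∈ → trans (lone-positive x uw x∈) (sym (lone-positive y uw y∈))
      2≤negN : 2 ℕ.≤ negN T p w
      2≤negN = count≥2 _ u v (cong₂ _∧_ (Adj⇒∈N[] (Adj-sym uw)) (cong not pu))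
                             (cong₂ _∧_ (Adj⇒∈N[] (Adj-sym vw))
                                        (cong not (outsider-negative v≢u ¬uv)))
                             (λ u≡v → v≢u (sym u≡v))

    centre-negative⇒InΘ : (∀ v → deg T v ℕ.≤ deg T u) → InΘ T (deg T u)
    centre-negative⇒InΘ max-deg with count-choose (adj T u) (ℕ.⌊n/2⌋≤n (deg T u))
    ... | S , S⊆N[u] , ∣S∣≡⌊deg/2⌋ =
      u , refl , S , S⊆N[u] , ∣S∣≡⌊deg/2⌋ , (λ v v≢u ¬uv → ⊥-elim (no-outsider v≢u ¬uv)) ,
      λ s _ → ℕ.≤-trans (max-deg s) (ℕ.m≤n⇒m≤1+n deg≤2)

  InΘ-from-centre : (∀ v → deg T v ℕ.≤ deg T u) → InΘ T (deg T u)
  InΘ-from-centre max-deg with p u in pu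
  ... | true  = centre-positive⇒InΘ pu
  ... | false = centre-negative⇒InΘ pu max-deg

extremal⇒InΘ : (T : Graph n) → Acyclic T → ∀ {p u} → IsNNSDFSigns T p →
  (∀ v → deg T v ℕ.≤ deg T u) → count p ≡ ⌈ suc (deg T u) /2⌉ → InΘ T (deg T u)
extremal⇒InΘ T acyclic nnsdf max-deg extremal =
  ExtremalSigns.InΘ-from-centre T acyclic nnsdf extremal max-deg

-- Trees in Θ attain the bound

module ThetaSigns {n} (T : Graph n) (acyclic : Acyclic T) {u : Fin n} {S : Subset n}
  (S⊆N[u] : ∀ s → s ∈ S → Adj T u s)
  (∣S∣≡⌊deg/2⌋ : ∣ S ∣ ≡ ⌊ deg T u /2⌋)
  (outsiders : ∀ v → v ≢ u → ¬ Adj T u v → deg T v ≡ 1 × (∀ w → Adj T v w → w ∈ S))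
  (S-deg≤3 : ∀ s → s ∈ S → deg T s ℕ.≤ 3) where
  open GraphProperties T

  q : Fin n → Bool
  q w = ⌊ u ≟ w ⌋ ∨ lookup S w

  open SignCounts T q

  q-centre : q u ≡ true
  q-centre = cong (_∨ lookup S u) (≟-refl u)

  q-S : ∀ {s} → s ∈ S → q s ≡ true
  q-S {s} s∈S = ∨≡trueʳ ⌊ u ≟ s ⌋ ([]=⇒lookup s∈S)

  count-q : count q ≡ ⌈ suc (deg T u) /2⌉
  count-q = begin
    count q
      ≡⟨ count-∨-disjoint (λ w → ⌊ u ≟ w ⌋) (lookup S) disjoint ⟩
    count (λ w → ⌊ u ≟ w ⌋) ℕ.+ count (lookup S)
      ≡⟨ cong (ℕ._+ count (lookup S)) (count-singleton u) ⟩
    suc (count (lookup S))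
      ≡⟨ cong suc (∣S∣≡count∘lookup S) ⟨
    suc ∣ S ∣
      ≡⟨ cong suc ∣S∣≡⌊deg/2⌋ ⟩
    suc ⌊ deg T u /2⌋
      ∎
    where
    open ≡-Reasoning
    disjoint : ∀ w → ⌊ u ≟ w ⌋ ≡ true → ¬ lookup S w ≡ true
    disjoint w u≟w Sw = Adj⇒≢ (S⊆N[u] w (lookup⇒[]= w S Sw)) (≟-sound u w u≟w)

  nnsdf-at-centre : negN T q u ℕ.≤ posN T q u
  nnsdf-at-centre = smaller≤larger (posN+negN≡1+deg u) (subst (ℕ._≤ posN T q u) count-q q⊆N[u])
    where
    q⊆N[u] : count q ℕ.≤ posN T q u
    q⊆N[u] = count-mono {g = q} {h = λ w → inN[ T ] u w ∧ q w} λ w qw → cong₂ _∧_ (∈N[u] w qw) qw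
      where
      ∈N[u] : ∀ w → q w ≡ true → inN[ T ] u w ≡ true
      ∈N[u] w qw with ∨≡true⁻ {⌊ u ≟ w ⌋} qw
      ... | inj₁ u≟w = cong (_∨ adj T u w) u≟w
      ... | inj₂ Sw  = Adj⇒∈N[] (S⊆N[u] w (lookup⇒[]= w S Sw))

  nnsdf-in-S : ∀ {s} → s ∈ S → negN T q s ℕ.≤ posN T q s
  nnsdf-in-S {s} s∈S = smaller≤larger (posN+negN≡1+deg s)
    (ℕ.≤-trans (ℕ.⌈n/2⌉-mono (s≤s (S-deg≤3 s s∈S))) 2≤posN)
    where
    us = S⊆N[u] s s∈S
    2≤posN : 2 ℕ.≤ posN T q s
    2≤posN = count≥2 _ s u (cong₂ _∧_ (∈N[]-self s) (q-S s∈S))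
                           (cong₂ _∧_ (Adj⇒∈N[] (Adj-sym us)) q-centre)
                           (λ s≡u → Adj⇒≢ us (sym s≡u))

  nnsdf-at-neighbour-outside-S : ∀ {v} → Adj T u v → lookup S v ≡ false → negN T q v ℕ.≤ posN T q v
  nnsdf-at-neighbour-outside-S {v} uv Sv =
    negN≤posN-if-lone-negative lone (cong₂ _∧_ (Adj⇒∈N[] (Adj-sym uv)) q-centre)
    where
    lone : ∀ w → (inN[ T ] v w ∧ not (q w)) ≡ true → w ≡ v
    lone w w∈N[v]∧¬qw with ∧≡true⁻ {inN[ T ] v w} w∈N[v]∧¬qw
    ... | w∈N[v] , ¬qw with ∈N[]⁻ {v} w∈N[v]
    ...   | inj₁ v≡w = sym v≡w
    ...   | inj₂ vw with w ≟ u
    ...     | yes refl = ⊥-elim (true≢false (trans (sym q-centre) (not≡true⁻ ¬qw)))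
    ...     | no w≢u with adj T u w in uw
    ...       | true  = ⊥-elim (no-triangle acyclic uv uw vw)
    ...       | false = ⊥-elim (true≢false (trans (sym ([]=⇒lookup v∈S)) Sv))
      where
      v∈S = proj₂ (outsiders w w≢u (λ uw′ → true≢false (trans (sym uw′) uw))) v (Adj-sym vw)

  nnsdf-at-outsider : ∀ {v} → v ≢ u → ¬ Adj T u v → negN T q v ℕ.≤ posN T q v
  nnsdf-at-outsider {v} v≢u ¬uv with outsiders v v≢u ¬uv
  ... | deg≡1 , N[v]⊆S with count-witness (adj T v) (ℕ.≤-reflexive (sym deg≡1))
  ...   | w , vw = negN≤posN-if-lone-negative lone (cong₂ _∧_ (Adj⇒∈N[] vw) (q-S (N[v]⊆S w vw)))
    where
    lone : ∀ x → (inN[ T ] v x ∧ not (q x)) ≡ true → x ≡ v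
    lone x x∈N[v]∧¬qx with ∧≡true⁻ {inN[ T ] v x} x∈N[v]∧¬qx
    ... | x∈N[v] , ¬qx with ∈N[]⁻ {v} x∈N[v]
    ...   | inj₁ v≡x = sym v≡x
    ...   | inj₂ vx  = ⊥-elim (true≢false (trans (sym (q-S (N[v]⊆S x vx))) (not≡true⁻ ¬qx)))

  nnsdf : IsNNSDFSigns T q
  nnsdf v with v ≟ u
  ... | yes refl = nnsdf-at-centre
  ... | no v≢u with adj T u v in uv | lookup S v in Sv
  ...   | false | _     = nnsdf-at-outsider v≢u (λ uv′ → true≢false (trans (sym uv′) uv))
  ...   | true  | true  = nnsdf-in-S (lookup⇒[]= v S Sv)
  ...   | true  | false = nnsdf-at-neighbour-outside-S uv Sv

InΘ⇒extremal : (T : Graph n) → Acyclic T → ∀ {Δ} → InΘ T Δ →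
  Σ[ p ∈ (Fin n → Bool) ] IsNNSDFSigns T p × count p ≡ ⌈ suc Δ /2⌉
InΘ⇒extremal T acyclic (u , refl , S , S⊆N[u] , ∣S∣≡⌊deg/2⌋ , outsiders , S-deg≤3) =
  q , nnsdf , count-q
  where open ThetaSigns T acyclic S⊆N[u] ∣S∣≡⌊deg/2⌋ outsiders S-deg≤3

theorem4p2 : (∀ (n : ℕ) (G : Graph n) (Δ : ℕ) (γ : ℤ) →
                 IsMaxDegree G Δ → IsGammaNN G γ → bound n Δ ≤ γ)
             × (∀ (n : ℕ) (T : Graph n) (Δ : ℕ) (γ : ℤ) →
                 IsTree T → IsMaxDegree T Δ → IsGammaNN T γ →
                 (γ ≡ bound n Δ) ⇔ InΘ T Δ)
theorem4p2 = lower-bound , characterisation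
  where
  lower-bound : ∀ n (G : Graph n) Δ γ → IsMaxDegree G Δ → IsGammaNN G γ → bound n Δ ≤ γ
  lower-bound n G Δ γ ((u , refl) , _) ((f , f-nnsdf , refl) , _) = bound≤weight G u f-nnsdf

  characterisation : ∀ n (T : Graph n) Δ γ → IsTree T → IsMaxDegree T Δ → IsGammaNN T γ →
                     (γ ≡ bound n Δ) ⇔ InΘ T Δ
  characterisation n T Δ γ (_ , acyclic) ((u , refl) , max-deg) ((f , f-nnsdf , refl) , minimal) =
    mk⇔ attained⇒InΘ InΘ⇒attained
    where
    attained⇒InΘ : weight f ≡ bound n (deg T u) → InΘ T (deg T u)
    attained⇒InΘ weight≡bound with IsNNSDF⇒signs T f-nnsdf
    ... | signs , weight≡ =
      extremal⇒InΘ T acyclic signs max-deg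
        (signWeight-injective {n} (trans (sym weight≡) weight≡bound))

    InΘ⇒attained : InΘ T (deg T u) → weight f ≡ bound n (deg T u)
    InΘ⇒attained θ with InΘ⇒extremal T acyclic θ
    ... | p , signs , count≡ = ℤ.≤-antisym
      (subst (weight f ≤_) (trans (weight≡signWeight T (λ _ → refl)) (cong (signWeight n) count≡))
             (minimal (sign ∘ p) (signs⇒IsNNSDF T signs)))
      (bound≤weight T u f-nnsdf)
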